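{- Let $G$ be a tree with $n\ge 3$ vertices, $\mathcal{C}$ a set of $k\ge2$ colors, $C\colon V(G)\to\mathcal{C}\cup\{\emptyset\}$ a coloring, and $\mathcal{P}(G,C)\subseteq\mathbb{R}^{\eta k}$ the polytope defined in the context. Let $\pi\in\mathbb{Z}^{\eta k}$. If the inequality $\pi x\le 1$ is facet-defining for $\mathcal{P}(G,C)$, then there exist $H^*\in\mathcal{G}(G)$ and $c^*\in\mathcal{C}$ such that $\pi x\le 1$ is exactly the inequality $$\sum_{H'\in\mathcal{G}_{\supset}(H^*)}\ \sum_{c'\in\mathcal{C}\setminus\{c^*\}} x_{H',c'}+\sum_{H'\in\mathcal{G}_{\cap}(H^*)} x_{H',c^*}\le 1.$$
   Context: $\mathcal{G}(G)$ is the collection of all subsets of $V(G)$ that induce connected subgraphs of $G$, and $\eta=|\mathcal{G}(G)|$. For $H\in\mathcal{G}(G)$, $\mathcal{G}_{\cap}(H)=\{H'\in\mathcal{G}(G): H'\cap H\neq\emptyset\}$ and $\mathcal{G}_{\supset}(H)=\{H'\in\mathcal{G}(G): H'\supseteq H\}$. $\mathcal{P}(G,C)\subseteq\mathbb{R}^{\eta k}$ (coordinates indexed by $(H,c)$, $H\in\mathcal{G}(G)$, $c\in\mathcal{C}$) is the convex hull of all $x\in\{0,1\}^{\eta k}$ satisfying $\sum_{H\in\mathcal{G}(G):v\in H}\sum_{c\in\mathcal{C}}x_{H,c}\le 1$ for every $v\in V(G)$ and $\sum_{H\in\mathcal{G}(G)}x_{H,c}\le 1$ for every $c\in\mathcal{C}$.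 -}

module Defs where

open import Data.Nat using (ℕ; zero; suc; _≤_)
open import Data.Integer using (ℤ; _+_; _*_; _<_) renaming (_≤_ to _≤ℤ_)
open import Data.Fin using (Fin; zero; suc; inject₁; fromℕ)
open import Data.Fin.Subset using (Subset; _∈_; _⊆_; _∩_; Nonempty; ⊤; inside; outside)
open import Data.Fin.Subset.Properties using (_⊆?_; nonempty?)
open import Data.Bool using (Bool; true; false)
open import Data.List using (List; []; _∷_; _++_; map; foldr; allFin)
open import Data.Vec using (_∷_; [])
open import Data.Maybe using (Maybe)
open import Data.Product using (Σ; ∃; _×_; _,_)
open import Function.Definitions using (Injective)
open import Relation.Nullary using (¬_; does)
open import Relation.Binary.PropositionalEquality using (_≡_; _≢_)
open import Data.Fin using (_≟_)

record Graph (n : ℕ) : Set where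
  field
    Adj     : Fin n → Fin n → Bool
    symAdj  : ∀ u v → Adj u v ≡ Adj v u
    irrefl  : ∀ u → Adj u u ≡ false
open Graph public

data WalkIn {n : ℕ} (G : Graph n) (H : Subset n) : Fin n → Fin n → Set where
  stop : ∀ {u} → u ∈ H → WalkIn G H u u
  step : ∀ {u w v} → u ∈ H → Adj G u w ≡ true → WalkIn G H w v → WalkIn G H u v

InducesConnected : {n : ℕ} → Graph n → Subset n → Set
InducesConnected G H = Nonempty H × (∀ u v → u ∈ H → v ∈ H → WalkIn G H u v)

HasCycle : {n : ℕ} → Graph n → Set
HasCycle {n} G = ∃ λ m → Σ (Fin (suc (suc (suc m))) → Fin n) λ cyc →
  Injective _≡_ _≡_ cyc ×
  (∀ (i : Fin (suc (suc m))) → Adj G (cyc (inject₁ i)) (cyc (suc i)) ≡ true) ×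
  Adj G (cyc (fromℕ (suc (suc m)))) (cyc zero) ≡ true

IsTree : {n : ℕ} → Graph n → Set
IsTree G = InducesConnected G ⊤ × ¬ HasCycle G

allSubsets : (n : ℕ) → List (Subset n)
allSubsets zero = [] ∷ []
allSubsets (suc n) = map (inside ∷_) (allSubsets n) ++ map (outside ∷_) (allSubsets n)

sumℤ : List ℤ → ℤ
sumℤ = foldr _+_ (Data.Integer.+ 0)

-- Points of ℝ^{ηk}: coordinates indexed by (H , c).  We index by all
-- subsets H; coordinates for non-connected H are forced to 0 on P.
Point : ℕ → ℕ → Set
Point n k = Subset n → Fin k → ℤ

dot : {n k : ℕ} → Point n k → Point n k → ℤ
dot {n} {k} π x = sumℤ (map (λ H → sumℤ (map (λ c → π H c * x H c) (allFin k))) (allSubsets n))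

-- 0/1 points satisfying the packing constraints (vertices of P(G,C))
Feasible : {n k : ℕ} → Graph n → Point n k → Set
Feasible {n} {k} G x =
  (∀ H c → (x H c ≡ Data.Integer.+ 0) Data.Sum.⊎ (x H c ≡ Data.Integer.+ 1)) ×
  (∀ H c → ¬ InducesConnected G H → x H c ≡ Data.Integer.+ 0) ×
  (∀ v → sumℤ (map (λ H → sumℤ (map (λ c → x H c) (allFin k))) (filterIn v (allSubsets n))) ≤ℤ Data.Integer.+ 1) ×
  (∀ c → sumℤ (map (λ H → x H c) (allSubsets n)) ≤ℤ Data.Integer.+ 1)
  where
  import Data.Sum
  open import Data.List using (filter)
  open import Data.Fin.Subset.Properties using (_∈?_)
  filterIn : Fin n → List (Subset n) → List (Subset n)
  filterIn v = filter (λ H → v ∈? H)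

-- points p₀ … p_{m-1} are affinely independent: the only (integer,
-- equivalently rational) affine dependence is trivial
AffinelyIndependent : {n k m : ℕ} → (Fin m → Point n k) → Set
AffinelyIndependent {n} {k} {m} ps =
  (λ′ : Fin m → ℤ) →
  sumℤ (map λ′ (allFin m)) ≡ Data.Integer.+ 0 →
  (∀ H c → sumℤ (map (λ i → λ′ i * ps i H c) (allFin m)) ≡ Data.Integer.+ 0) →
  ∀ i → λ′ i ≡ Data.Integer.+ 0

HasAffIndep : {n k : ℕ} → (Point n k → Set) → ℕ → Set
HasAffIndep {n} {k} S m =
  Σ (Fin m → Point n k) λ ps → (∀ i → S (ps i)) × AffinelyIndependent ps

-- π x ≤ 1 is facet-defining for P(G,C) = conv(Feasible G):
-- valid, proper, and dim(face) = dim(P) - 1 (dim P = d means at most d+1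
-- affinely independent vertices; the face is the convex hull of the
-- vertices with π x = 1).
FacetDefining : {n k : ℕ} → Graph n → Point n k → Set
FacetDefining {n} {k} G π =
  (∀ x → Feasible G x → dot π x ≤ℤ Data.Integer.+ 1) ×
  (∃ λ x → Feasible G x × dot π x < Data.Integer.+ 1) ×
  (∃ λ d → HasAffIndep {n} {k} (Feasible G) (suc d) ×
           ¬ HasAffIndep {n} {k} (Feasible G) (suc (suc d)) ×
           HasAffIndep {n} {k} (λ x → Feasible G x × dot π x ≡ Data.Integer.+ 1) d)

starCoeff : {n k : ℕ} → Subset n → Fin k → Subset n → Fin k → ℤ
starCoeff Hs cs H' c' with does (c' ≟ cs)
... | true  with does (nonempty? (H' ∩ Hs))
...   | true  = Data.Integer.+ 1
...   | false = Data.Integer.+ 0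
starCoeff Hs cs H' c' | false with does (Hs ⊆? H')
...   | true  = Data.Integer.+ 1
...   | false = Data.Integer.+ 0

{-# OPTIONS --safe #-}
module Submission where

-- A 0/1 point of P(G,C) is a packing: a set of pairs (H , c) no two of which conflict,
-- where (H , c) and (H′ , c′) conflict when c ≡ c′ or H ∩ H′ is nonempty.  Let π x ≤ 1
-- define a facet, with d affinely independent tight points and no d + 2 affinely
-- independent feasible points.  Every connected pair (H , c) is used by a tight point,
-- for otherwise the unit vector at (H , c) and the origin extend the tight points to
-- d + 2 independent ones.  Validity at that unit vector and at a tight point with
-- (H , c) removed give π H c ∈ {0, 1}; validity at sums of two unit vectors makes the
-- support K of π a clique of the conflict graph, and a tight point using a pair with
-- coefficient 0 uses a support pair not conflicting with it, so K is a maximal clique.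
--
-- In a tree the connected vertex sets are subtrees, and subtrees have the Helly
-- property.  If K has two disjoint sets of one colour c*, then two sets of K of another
-- colour both meet these two disjoint subtrees and hence each other; otherwise any two
-- sets of K of equal colour meet.  Either way the sets of K with colours other than c*
-- pairwise meet, their intersection H* is a nonempty subtree, and K lies in the star of
-- (H* , c*).  Stars are cliques, so by maximality π is the star inequality.

open import Defs
open import Data.Bool using (true; false)
import Data.Bool as Bool
open import Data.Empty using (⊥)
open import Data.Fin using (Fin; zero; suc; inject₁; fromℕ; _≟_)
import Data.Fin.Properties as Fin
open import Data.Fin.Subset using (Subset; _∈_; _⊆_; _∩_; _∪_; Nonempty; ⋂; ⊤; inside; outside)
open import Data.Fin.Subset.Properties
  using (x∈p∩q⁺; x∈p∩q⁻; x∈p∪q⁻; p⊆p∪q; q⊆p∪q; ∈⊤; nonempty?; _∈?_; _⊆?_; anySubset?)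
open import Data.Integer using (ℤ; +_; -[1+_]; _+_; _*_; +≤+; -≤-) renaming (_≤_ to _≤ℤ_)
open import Data.Integer.Properties
  using (≤-refl; ≤-trans; +-comm; +-identityˡ; +-identityʳ; +-mono-≤; +-monoʳ-≤; *-zeroʳ; *-identityʳ; *-distribˡ-+)
  renaming (_≟_ to _≟ℤ_)
open import Data.Integer.Tactic.RingSolver using (solve-∀)
open import Data.List using (List; []; _∷_; _++_; [_]; map; filter; allFin; length; lookup; reverse; _ʳ++_)
import Data.List.Properties as List
open import Data.List.Membership.Propositional using () renaming (_∈_ to _∈L_)
open import Data.List.Membership.Propositional.Properties
  using (∈-∃++; ∈-++⁺ˡ; ∈-++⁺ʳ; ∈-lookup; ∈-map⁺; ∈-map⁻; ∈-filter⁺; ∈-filter⁻; ∈-allFin)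
open import Data.List.Relation.Binary.Subset.Propositional using () renaming (_⊆_ to _⊆L_)
open import Data.List.Relation.Binary.Subset.Propositional.Properties using (⊆-refl; ⊆-trans; ∷⁺ʳ; All-resp-⊇)
open import Data.List.Relation.Unary.All using (All; []; _∷_)
import Data.List.Relation.Unary.All as All
open import Data.List.Relation.Unary.All.Properties using (¬Any⇒All¬; ++⁻ˡ; ++⁻ʳ)
open import Data.List.Relation.Unary.AllPairs using ([]; _∷_)
open import Data.List.Relation.Unary.Any using (here; there)
open import Data.List.Relation.Unary.Unique.Propositional using (Unique)
import Data.List.Relation.Unary.Unique.Propositional.Properties as Unique
open import Data.Maybe using (Maybe)
open import Data.Nat using (ℕ; zero; suc; _≤_; z≤n; s≤s)
open import Data.Product using (Σ; ∃; ∃₂; _×_; _,_; proj₁; proj₂)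
import Data.Product.Properties as Product
open import Data.Product.Properties using (,-injectiveˡ; ,-injectiveʳ)
open import Data.Sum using (_⊎_; inj₁; inj₂; [_,_]′)
open import Data.Unit using (tt) renaming (⊤ to Unit)
open import Data.Vec using ([]; _∷_)
import Data.Vec.Properties as Vec
open import Data.Vec.Functional using () renaming (_∷_ to _∷ᶠ_)
open import Function using (_∘_; case_of_)
open import Relation.Nullary using (¬_; Dec; yes; no; contradiction; ¬?)
open import Relation.Nullary.Decidable using (_×-dec_; _⊎-dec_; _→-dec_; map′; decidable-stable)
open import Relation.Binary.PropositionalEquality
  using (_≡_; _≢_; refl; sym; trans; cong; cong₂; subst; subst₂; module ≡-Reasoning)

∑ : {A : Set} → List A → (A → ℤ) → ℤ
∑ xs f = sumℤ (map f xs)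

infix 2 ∑
syntax ∑ xs (λ x → e) = ∑[ x ← xs ] e

module _ {A : Set} where

  ∑-cong : ∀ xs {f g : A → ℤ} → (∀ {x} → x ∈L xs → f x ≡ g x) → ∑ xs f ≡ ∑ xs g
  ∑-cong []       f≡g = refl
  ∑-cong (x ∷ xs) f≡g = cong₂ _+_ (f≡g (here refl)) (∑-cong xs (f≡g ∘ there))

  ∑-zero : ∀ xs {f : A → ℤ} → (∀ {x} → x ∈L xs → f x ≡ + 0) → ∑ xs f ≡ + 0
  ∑-zero []       f≡0 = refl
  ∑-zero (x ∷ xs) f≡0 = cong₂ _+_ (f≡0 (here refl)) (∑-zero xs (f≡0 ∘ there))

  ∑-+ : ∀ xs (f g : A → ℤ) → (∑[ x ← xs ] f x + g x) ≡ ∑ xs f + ∑ xs g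
  ∑-+ []       f g = refl
  ∑-+ (x ∷ xs) f g = trans (cong (λ s → f x + g x + s) (∑-+ xs f g)) (interchange (f x) (g x) _ _)
    where
    interchange : ∀ a b c d → (a + b) + (c + d) ≡ (a + c) + (b + d)
    interchange = solve-∀

  *-∑ : ∀ xs c (f : A → ℤ) → c * ∑ xs f ≡ (∑[ x ← xs ] c * f x)
  *-∑ []       c f = *-zeroʳ c
  *-∑ (x ∷ xs) c f = trans (*-distribˡ-+ c (f x) (∑ xs f)) (cong (λ s → c * f x + s) (*-∑ xs c f))

  ∑-mono-≤ : ∀ xs {f g : A → ℤ} → (∀ {x} → x ∈L xs → f x ≤ℤ g x) → ∑ xs f ≤ℤ ∑ xs g
  ∑-mono-≤ []       f≤g = ≤-refl
  ∑-mono-≤ (x ∷ xs) f≤g = +-mono-≤ (f≤g (here refl)) (∑-mono-≤ xs (f≤g ∘ there))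

  ∑-nonNegative : ∀ xs {f : A → ℤ} → (∀ {x} → x ∈L xs → + 0 ≤ℤ f x) → + 0 ≤ℤ ∑ xs f
  ∑-nonNegative xs {f} 0≤f = subst (_≤ℤ ∑ xs f) (∑-zero xs {λ _ → + 0} (λ _ → refl)) (∑-mono-≤ xs 0≤f)

  term≤∑ : ∀ xs {f : A → ℤ} → (∀ {x} → x ∈L xs → + 0 ≤ℤ f x) → ∀ {a} → a ∈L xs → f a ≤ℤ ∑ xs f
  term≤∑ (x ∷ xs) {f} 0≤f (here refl) =
    subst (_≤ℤ f x + ∑ xs f) (+-identityʳ (f x)) (+-monoʳ-≤ (f x) (∑-nonNegative xs (0≤f ∘ there)))
  term≤∑ (x ∷ xs) {f} 0≤f {a} (there a∈) =
    subst (_≤ℤ f x + ∑ xs f) (+-identityˡ (f a)) (+-mono-≤ (0≤f (here refl)) (term≤∑ xs (0≤f ∘ there) a∈))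

  twoTerms≤∑ : ∀ xs {f : A → ℤ} → (∀ {x} → x ∈L xs → + 0 ≤ℤ f x) →
               ∀ {a b} → a ∈L xs → b ∈L xs → a ≢ b → f a + f b ≤ℤ ∑ xs f
  twoTerms≤∑ (x ∷ xs) 0≤f (here refl) (here refl) a≢b = contradiction refl a≢b
  twoTerms≤∑ (x ∷ xs) {f} 0≤f (here refl) (there b∈) a≢b =
    +-monoʳ-≤ (f x) (term≤∑ xs (0≤f ∘ there) b∈)
  twoTerms≤∑ (x ∷ xs) {f} 0≤f {a} (there a∈) (here refl) a≢b =
    subst (_≤ℤ f x + ∑ xs f) (+-comm (f x) (f a)) (+-monoʳ-≤ (f x) (term≤∑ xs (0≤f ∘ there) a∈))
  twoTerms≤∑ (x ∷ xs) {f} 0≤f {a} {b} (there a∈) (there b∈) a≢b =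
    subst (_≤ℤ f x + ∑ xs f) (+-identityˡ (f a + f b))
          (+-mono-≤ (0≤f (here refl)) (twoTerms≤∑ xs (0≤f ∘ there) a∈ b∈ a≢b))

  ∑-nonZero : ∀ xs (f : A → ℤ) → ∑ xs f ≢ + 0 → ∃ λ x → x ∈L xs × f x ≢ + 0
  ∑-nonZero []       f ∑≢0 = contradiction refl ∑≢0
  ∑-nonZero (x ∷ xs) f ∑≢0 with f x ≟ℤ + 0
  ... | no  fx≢0 = x , here refl , fx≢0
  ... | yes fx≡0 with ∑-nonZero xs f (λ ∑xs≡0 → ∑≢0 (cong₂ _+_ fx≡0 ∑xs≡0))
  ...   | y , y∈ , fy≢0 = y , there y∈ , fy≢0

  ∑-singleTerm : ∀ xs (f : A → ℤ) → Unique xs → ∀ {a} → a ∈L xs →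
                 (∀ {x} → x ∈L xs → x ≢ a → f x ≡ + 0) → ∑ xs f ≡ f a
  ∑-singleTerm (x ∷ xs) f uniq (here refl) rest≡0 =
    trans (cong (λ s → f x + s) (∑-zero xs (λ y∈ → rest≡0 (there y∈) (λ { refl → x∉xs y∈ }))))
          (+-identityʳ (f x))
    where x∉xs = Unique.Unique[x∷xs]⇒x∉xs uniq
  ∑-singleTerm (x ∷ xs) f uniq@(_ ∷ uniq′) (there a∈) rest≡0 =
    trans (cong (_+ ∑ xs f) (rest≡0 (here refl) (λ { refl → x∉xs a∈ })))
          (trans (+-identityˡ _) (∑-singleTerm xs f uniq′ a∈ (rest≡0 ∘ there)))
    where x∉xs = Unique.Unique[x∷xs]⇒x∉xs uniq

  ∑≤1 : ∀ xs (f : A → ℤ) → Unique xs → (∀ {x} → x ∈L xs → f x ≤ℤ + 1) →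
        (∀ {x y} → x ∈L xs → y ∈L xs → f x ≢ + 0 → f y ≢ + 0 → x ≡ y) → ∑ xs f ≤ℤ + 1
  ∑≤1 xs f uniq f≤1 atMostOne with ∑ xs f ≟ℤ + 0
  ... | yes ∑≡0 = subst (_≤ℤ + 1) (sym ∑≡0) (+≤+ z≤n)
  ... | no  ∑≢0 with ∑-nonZero xs f ∑≢0
  ...   | a , a∈ , fa≢0 = subst (_≤ℤ + 1) (sym (∑-singleTerm xs f uniq a∈ others≡0)) (f≤1 a∈)
    where
    others≡0 : ∀ {x} → x ∈L xs → x ≢ a → f x ≡ + 0
    others≡0 {x} x∈ x≢a with f x ≟ℤ + 0
    ... | yes fx≡0 = fx≡0
    ... | no  fx≢0 = contradiction (atMostOne x∈ a∈ fx≢0 fa≢0) x≢a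

module _ {A B : Set} where

  ∑-comm : ∀ xs ys (f : A → B → ℤ) →
           (∑[ x ← xs ] ∑[ y ← ys ] f x y) ≡ (∑[ y ← ys ] ∑[ x ← xs ] f x y)
  ∑-comm []       ys f = sym (∑-zero ys (λ _ → refl))
  ∑-comm (x ∷ xs) ys f = trans (cong (λ s → ∑ ys (f x) + s) (∑-comm xs ys f)) (sym (∑-+ ys (f x) _))

∑-allFin-suc : ∀ {m} (f : Fin (suc m) → ℤ) → ∑ (allFin (suc m)) f ≡ f zero + (∑[ i ← allFin m ] f (suc i))
∑-allFin-suc {m} f = cong (λ ys → f zero + sumℤ ys)
  (trans (List.map-tabulate suc f) (sym (List.map-tabulate (λ i → i) (λ i → f (suc i)))))

01⇒0≤ : ∀ {z} → z ≡ + 0 ⊎ z ≡ + 1 → + 0 ≤ℤ z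
01⇒0≤ (inj₁ refl) = +≤+ z≤n
01⇒0≤ (inj₂ refl) = +≤+ z≤n

01⇒≤1 : ∀ {z} → z ≡ + 0 ⊎ z ≡ + 1 → z ≤ℤ + 1
01⇒≤1 (inj₁ refl) = +≤+ z≤n
01⇒≤1 (inj₂ refl) = +≤+ (s≤s z≤n)

01∧≢0⇒≡1 : ∀ {z} → z ≡ + 0 ⊎ z ≡ + 1 → z ≢ + 0 → z ≡ + 1
01∧≢0⇒≡1 (inj₁ z≡0) z≢0 = contradiction z≡0 z≢0
01∧≢0⇒≡1 (inj₂ z≡1) _   = z≡1

0≤z≤1⇒01 : ∀ z → + 0 ≤ℤ z → z ≤ℤ + 1 → z ≡ + 0 ⊎ z ≡ + 1
0≤z≤1⇒01 (+ 0)           _ _                = inj₁ refl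
0≤z≤1⇒01 (+ 1)           _ _                = inj₂ refl
0≤z≤1⇒01 (+ suc (suc _)) _ (+≤+ (s≤s ()))
0≤z≤1⇒01 -[1+ _ ]        () _

1+1≰1 : ∀ {y z} → y ≡ + 1 → z ≡ + 1 → ¬ (y + z ≤ℤ + 1)
1+1≰1 refl refl (+≤+ (s≤s ()))

y+z≡1⇒y≤1⇒0≤z : ∀ {y} z → y + z ≡ + 1 → y ≤ℤ + 1 → + 0 ≤ℤ z
y+z≡1⇒y≤1⇒0≤z (+ _)    _     _   = +≤+ z≤n
y+z≡1⇒y≤1⇒0≤z -[1+ _ ] y+z≡1 y≤1 with subst (_≤ℤ + 0) y+z≡1 (+-mono-≤ y≤1 (-≤- z≤n))
... | +≤+ ()

allSubsets-complete : ∀ {n} (H : Subset n) → H ∈L allSubsets n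
allSubsets-complete []             = here refl
allSubsets-complete (true ∷ H)     = ∈-++⁺ˡ (∈-map⁺ (inside ∷_) (allSubsets-complete H))
allSubsets-complete {suc n} (false ∷ H) =
  ∈-++⁺ʳ (map (inside ∷_) (allSubsets n)) (∈-map⁺ (outside ∷_) (allSubsets-complete H))

allSubsets-unique : ∀ n → Unique (allSubsets n)
allSubsets-unique zero    = [] ∷ []
allSubsets-unique (suc n) = Unique.++⁺ (Unique.map⁺ Vec.∷-injectiveʳ (allSubsets-unique n))
                                       (Unique.map⁺ Vec.∷-injectiveʳ (allSubsets-unique n)) disjoint
  where
  disjoint : ∀ {H} → ¬ (H ∈L map (inside ∷_) (allSubsets n) × H ∈L map (outside ∷_) (allSubsets n))
  disjoint (H∈ , H∈′) with ∈-map⁻ (inside ∷_) H∈ | ∈-map⁻ (outside ∷_) H∈′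
  ... | _ , _ , refl | _ , _ , eq with Vec.∷-injectiveˡ eq
  ... | ()

module _ {n : ℕ} where

  ∈⋂⁻ : ∀ {x : Fin n} F → x ∈ ⋂ F → ∀ {A} → A ∈L F → x ∈ A
  ∈⋂⁻ (A ∷ F) x∈⋂ (here refl) = proj₁ (x∈p∩q⁻ A (⋂ F) x∈⋂)
  ∈⋂⁻ (A ∷ F) x∈⋂ (there A∈F) = ∈⋂⁻ F (proj₂ (x∈p∩q⁻ A (⋂ F) x∈⋂)) A∈F

  setsContaining : Fin n → List (Subset n)
  setsContaining v = filter (v ∈?_) (allSubsets n)

  setsContaining⁺ : ∀ {v H} → v ∈ H → H ∈L setsContaining v
  setsContaining⁺ {v} {H} v∈H = ∈-filter⁺ (v ∈?_) (allSubsets-complete H) v∈H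

  setsContaining⁻ : ∀ {v H} → H ∈L setsContaining v → v ∈ H
  setsContaining⁻ {v} H∈ = proj₂ (∈-filter⁻ (v ∈?_) {xs = allSubsets n} H∈)

  setsContaining-unique : ∀ v → Unique (setsContaining v)
  setsContaining-unique v = Unique.filter⁺ (v ∈?_) (allSubsets-unique n)

  _≟ˢ_ : (H H′ : Subset n) → Dec (H ≡ H′)
  _≟ˢ_ = Vec.≡-dec Bool._≟_

  ∩-comm-nonempty : ∀ {A B : Subset n} → Nonempty (A ∩ B) → Nonempty (B ∩ A)
  ∩-comm-nonempty {A} {B} (x , x∈A∩B) = x , x∈p∩q⁺ (proj₂ (x∈p∩q⁻ A B x∈A∩B) , proj₁ (x∈p∩q⁻ A B x∈A∩B))

module _ {A : Set} where

  Unique[xs++x∷ys]⇒Unique[x∷xs] : ∀ (xs : List A) {x ys} → Unique (xs ++ x ∷ ys) → Unique (x ∷ xs)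
  Unique[xs++x∷ys]⇒Unique[x∷xs] []       _            = [] ∷ []
  Unique[xs++x∷ys]⇒Unique[x∷xs] (y ∷ xs) (y∉ ∷ uniq) with Unique[xs++x∷ys]⇒Unique[x∷xs] xs uniq
  ... | x∉xs ∷ uniqxs = ((All.head (++⁻ʳ xs y∉) ∘ sym) ∷ x∉xs) ∷ (++⁻ˡ xs y∉ ∷ uniqxs)

  lookup-injective : ∀ (xs : List A) → Unique xs → ∀ i j → lookup xs i ≡ lookup xs j → i ≡ j
  lookup-injective (_ ∷ _)  _          zero    zero    _  = refl
  lookup-injective (_ ∷ _)  uniq       zero    (suc j) eq =
    contradiction (subst (_∈L _) (sym eq) (∈-lookup j)) (Unique.Unique[x∷xs]⇒x∉xs uniq)
  lookup-injective (_ ∷ _)  uniq       (suc i) zero    eq =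
    contradiction (subst (_∈L _) eq (∈-lookup i)) (Unique.Unique[x∷xs]⇒x∉xs uniq)
  lookup-injective (_ ∷ xs) (_ ∷ uniq) (suc i) (suc j) eq = cong suc (lookup-injective xs uniq i j eq)

  ʳ++-longer : ∀ (xs : List A) {y z zs v} → xs ʳ++ y ∷ z ∷ zs ≢ [ v ]
  ʳ++-longer []       eq = case List.∷-injectiveʳ eq of λ ()
  ʳ++-longer (x ∷ xs) eq = ʳ++-longer xs eq

  ʳ++-singleton : ∀ (xs ys : List A) {m v} → xs ʳ++ m ∷ ys ≡ [ v ] → xs ≡ [] × ys ≡ []
  ʳ++-singleton []       ys eq = refl , List.∷-injectiveʳ eq
  ʳ++-singleton (x ∷ xs) ys eq = contradiction eq (ʳ++-longer xs)

module Walks {n : ℕ} (G : Graph n) where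

  Edge : Fin n → Fin n → Set
  Edge u v = Adj G u v ≡ true

  data Walk : Fin n → Fin n → List (Fin n) → Set where
    done : ∀ u → Walk u u [ u ]
    hop  : ∀ {u w v xs} → Edge u w → Walk w v (w ∷ xs) → Walk u v (u ∷ w ∷ xs)

  edge-irreflexive : ∀ {u} → ¬ Edge u u
  edge-irreflexive {u} e with trans (sym e) (irrefl G u)
  ... | ()

  walk-start : ∀ {u v x xs} → Walk u v (x ∷ xs) → x ≡ u
  walk-start (done _)  = refl
  walk-start (hop _ _) = refl

  walk-end∈ : ∀ {u v xs} → Walk u v xs → v ∈L xs
  walk-end∈ (done _)  = here refl
  walk-end∈ (hop _ W) = there (walk-end∈ W)

  walk-suffix : ∀ {u v} xs {m ys} → Walk u v (xs ++ m ∷ ys) → Walk m v (m ∷ ys)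
  walk-suffix []           W with walk-start W
  ... | refl = W
  walk-suffix (_ ∷ [])     (hop _ W) = W
  walk-suffix (_ ∷ y ∷ xs) (hop _ W) = walk-suffix (y ∷ xs) W

  walk-prefix : ∀ {u v} xs {m ys} → Walk u v (xs ++ m ∷ ys) → Walk u m (xs ++ [ m ])
  walk-prefix []           W with walk-start W
  ... | refl = done _
  walk-prefix (_ ∷ [])     (hop e W) = hop e (walk-prefix [] W)
  walk-prefix (_ ∷ y ∷ xs) (hop e W) = hop e (walk-prefix (y ∷ xs) W)

  walk-ʳ++ : ∀ {m a c} xs ys → Walk m a (m ∷ xs) → Walk m c (m ∷ ys) → Walk a c (xs ʳ++ m ∷ ys)
  walk-ʳ++           []       ys (done _)  W′ = W′
  walk-ʳ++ {m} (x ∷ xs) ys (hop e W) W′ = walk-ʳ++ xs (m ∷ ys) W (hop (trans (symAdj G x m) e) W′)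

  walk-lookup-edge : ∀ {u v} x t ys → Walk u v (x ∷ t ++ ys) → (i : Fin (length t)) →
                     Edge (lookup (x ∷ t) (inject₁ i)) (lookup (x ∷ t) (suc i))
  walk-lookup-edge x (y ∷ t) ys (hop e W) zero    = e
  walk-lookup-edge x (y ∷ t) ys (hop e W) (suc i) = walk-lookup-edge y t ys W i

  walk-lookup-last : ∀ {u v} x t w → Walk u v (x ∷ t ++ [ w ]) → Edge (lookup (x ∷ t) (fromℕ (length t))) w
  walk-lookup-last x []      w (hop e W) = e
  walk-lookup-last x (y ∷ t) w (hop e W) = walk-lookup-last y t w W

  NonBacktracking : List (Fin n) → Set
  NonBacktracking (x ∷ y ∷ z ∷ xs) = x ≢ z × NonBacktracking (y ∷ z ∷ xs)
  NonBacktracking _                = Unit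

  nonBacktracking-tail : ∀ x xs → NonBacktracking (x ∷ xs) → NonBacktracking xs
  nonBacktracking-tail _ []           _        = tt
  nonBacktracking-tail _ (_ ∷ [])     _        = tt
  nonBacktracking-tail _ (_ ∷ _ ∷ _)  (_ , nb) = nb

  nonBacktracking-suffix : ∀ xs ys → NonBacktracking (xs ++ ys) → NonBacktracking ys
  nonBacktracking-suffix []       ys nb = nb
  nonBacktracking-suffix (x ∷ xs) ys nb = nonBacktracking-suffix xs ys (nonBacktracking-tail x (xs ++ ys) nb)

  HeadsDiffer : List (Fin n) → List (Fin n) → Set
  HeadsDiffer (x ∷ _) (y ∷ _) = x ≢ y
  HeadsDiffer _       _       = Unit

  nonBacktracking-ʳ++ : ∀ m xs ys → NonBacktracking (m ∷ xs) → NonBacktracking (m ∷ ys) →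
                        HeadsDiffer xs ys → NonBacktracking (xs ʳ++ m ∷ ys)
  nonBacktracking-ʳ++ m []       ys _   nb′ _     = nb′
  nonBacktracking-ʳ++ m (x ∷ xs) ys nb  nb′ x≢y =
    nonBacktracking-ʳ++ x xs (m ∷ ys) (nonBacktracking-tail m (x ∷ xs) nb) (turn ys nb′ x≢y) (heads xs nb)
    where
    turn : ∀ ys → NonBacktracking (m ∷ ys) → HeadsDiffer (x ∷ xs) ys → NonBacktracking (x ∷ m ∷ ys)
    turn []      _   _   = tt
    turn (_ ∷ _) nb′ x≢y = x≢y , nb′
    heads : ∀ xs → NonBacktracking (m ∷ x ∷ xs) → HeadsDiffer xs (m ∷ ys)
    heads []      _          = tt
    heads (_ ∷ _) (m≢z , _) = m≢z ∘ sym

  record Path (u v : Fin n) : Set where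
    constructor mkPath
    field
      vertices        : List (Fin n)
      walk            : Walk u v vertices
      nonBacktracking : NonBacktracking vertices
  open Path public

  _◅_ : ∀ {u w v} → Edge u w → (P : Path w v) → Σ (Path u v) λ Q → vertices Q ⊆L u ∷ vertices P
  e ◅ mkPath _ (done w) _ = mkPath _ (hop e (done w)) tt , ⊆-refl
  _◅_ {u} e (mkPath _ (hop {w = y} e′ W) nb) with y ≟ u
  ... | yes refl = mkPath _ W (nonBacktracking-tail _ _ nb) , there ∘ there
  ... | no  y≢u  = mkPath _ (hop e (hop e′ W)) (y≢u ∘ sym , nb) , ⊆-refl

  reduce : ∀ {u v xs} → Walk u v xs → Σ (Path u v) λ P → vertices P ⊆L xs
  reduce (done u)  = mkPath _ (done u) tt , ⊆-refl
  reduce (hop e W) with reduce W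
  ... | P , P⊆ with e ◅ P
  ...   | Q , Q⊆ = Q , ⊆-trans Q⊆ (∷⁺ʳ _ P⊆)

  record Fork (xs ys : List (Fin n)) : Set where
    constructor mkFork
    field
      stem        : List (Fin n)
      branch      : Fin n
      left right  : List (Fin n)
      xs-split    : xs ≡ stem ++ branch ∷ left
      ys-split    : ys ≡ stem ++ branch ∷ right
      diverge     : HeadsDiffer left right

  fork : ∀ {b a c xs ys} → Walk b a xs → Walk b c ys → Fork xs ys
  fork (done b)  (done _)   = mkFork [] b [] [] refl refl tt
  fork (done b)  (hop _ _)  = mkFork [] b [] _ refl refl tt
  fork (hop _ _) (done b)   = mkFork [] b _ [] refl refl tt
  fork {b} (hop {w = x} _ W) (hop {w = y} _ W′) with x ≟ y
  ... | no  x≢y  = mkFork [] b _ _ refl refl x≢y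
  ... | yes refl = mkFork (b ∷ stem) branch left right (cong (b ∷_) xs-split) (cong (b ∷_) ys-split) diverge
    where open Fork (fork W W′)

  module Junction {b a c} (P : Path b a) (Q : Path b c) where

    open Fork (fork (walk P) (walk Q)) public

    -- P backwards from a to the branch point, then Q onwards to c.
    detour : Path a c
    detour = mkPath (left ʳ++ branch ∷ right)
      (walk-ʳ++ left right (walk-suffix stem (subst (Walk b a) xs-split (walk P)))
                           (walk-suffix stem (subst (Walk b c) ys-split (walk Q))))
      (nonBacktracking-ʳ++ branch left right
        (nonBacktracking-suffix stem _ (subst NonBacktracking xs-split (nonBacktracking P)))
        (nonBacktracking-suffix stem _ (subst NonBacktracking ys-split (nonBacktracking Q)))
        diverge)

    branch∈P : branch ∈L vertices P
    branch∈P = subst (branch ∈L_) (sym xs-split) (∈-++⁺ʳ stem (here refl))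

    branch∈Q : branch ∈L vertices Q
    branch∈Q = subst (branch ∈L_) (sym ys-split) (∈-++⁺ʳ stem (here refl))

    branch∈detour : branch ∈L vertices detour
    branch∈detour = subst (branch ∈L_) (sym (List.ʳ++-defn left)) (∈-++⁺ʳ (reverse left) (here refl))

  walkIn⇒walk : ∀ {S u v} → WalkIn G S u v → ∃ λ xs → Walk u v xs × All (_∈ S) xs
  walkIn⇒walk (stop u∈S) = _ , done _ , u∈S ∷ []
  walkIn⇒walk (step u∈S e W) with walkIn⇒walk W
  ... | _ , W′@(done _)  , xs⊆S = _ , hop e W′ , u∈S ∷ xs⊆S
  ... | _ , W′@(hop _ _) , xs⊆S = _ , hop e W′ , u∈S ∷ xs⊆S

  walk⇒walkIn : ∀ {S u v xs} → Walk u v xs → All (_∈ S) xs → WalkIn G S u v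
  walk⇒walkIn (done _)  (u∈S ∷ [])    = stop u∈S
  walk⇒walkIn (hop e W) (u∈S ∷ xs⊆S) = step u∈S e (walk⇒walkIn W xs⊆S)

  walkIn-mono : ∀ {S T u v} → (∀ {x} → x ∈ S → x ∈ T) → WalkIn G S u v → WalkIn G T u v
  walkIn-mono S⊆T (stop u∈S)     = stop (S⊆T u∈S)
  walkIn-mono S⊆T (step u∈S e W) = step (S⊆T u∈S) e (walkIn-mono S⊆T W)

  walkIn-++ : ∀ {S u w v} → WalkIn G S u w → WalkIn G S w v → WalkIn G S u v
  walkIn-++ (stop _)       W′ = W′
  walkIn-++ (step u∈S e W) W′ = step u∈S e (walkIn-++ W W′)

  ∪-connected : ∀ {A B} → InducesConnected G A → InducesConnected G B → Nonempty (A ∩ B) →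
                InducesConnected G (A ∪ B)
  ∪-connected {A} {B} ((a , a∈A) , connA) (_ , connB) (w , w∈A∩B) = (a , p⊆p∪q B a∈A) , connA∪B
    where
    w∈A = proj₁ (x∈p∩q⁻ A B w∈A∩B)
    w∈B = proj₂ (x∈p∩q⁻ A B w∈A∩B)
    inA : ∀ {u v} → WalkIn G A u v → WalkIn G (A ∪ B) u v
    inA = walkIn-mono (p⊆p∪q B)
    inB : ∀ {u v} → WalkIn G B u v → WalkIn G (A ∪ B) u v
    inB = walkIn-mono (q⊆p∪q A B)
    connA∪B : ∀ u v → u ∈ A ∪ B → v ∈ A ∪ B → WalkIn G (A ∪ B) u v
    connA∪B u v u∈ v∈ with x∈p∪q⁻ A B u∈ | x∈p∪q⁻ A B v∈
    ... | inj₁ u∈A | inj₁ v∈A = inA (connA u v u∈A v∈A)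
    ... | inj₁ u∈A | inj₂ v∈B = walkIn-++ (inA (connA u w u∈A w∈A)) (inB (connB w v w∈B v∈B))
    ... | inj₂ u∈B | inj₁ v∈A = walkIn-++ (inB (connB u w u∈B w∈B)) (inA (connA w v w∈A v∈A))
    ... | inj₂ u∈B | inj₂ v∈B = inB (connB u v u∈B v∈B)

module Trees {n : ℕ} (G : Graph n) (tree : IsTree G) where

  open Walks G

  Connected : Subset n → Set
  Connected = InducesConnected G

  closedWalk⇒HasCycle : ∀ x y z t → Walk x x (x ∷ y ∷ z ∷ t ++ [ x ]) → Unique (x ∷ y ∷ z ∷ t) → HasCycle G
  closedWalk⇒HasCycle x y z t W uniq =
    length t , lookup (x ∷ y ∷ z ∷ t) , (λ {i} {j} → lookup-injective _ uniq i j) ,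
    walk-lookup-edge x (y ∷ z ∷ t) [ x ] W , walk-lookup-last x (y ∷ z ∷ t) x W

  nonBacktracking-noReturn : ∀ {u w v xs} → Edge u w → Walk w v (w ∷ xs) →
                             NonBacktracking (u ∷ w ∷ xs) → Unique (w ∷ xs) → ¬ u ∈L w ∷ xs
  -- A first return to u is a loop, an immediate backtrack, or closes a cycle.
  nonBacktracking-noReturn e W nb uniq u∈ with ∈-∃++ u∈
  ... | []        , _ , refl = edge-irreflexive e
  ... | _ ∷ []    , _ , refl = proj₁ nb refl
  ... | y ∷ z ∷ t , _ , refl = proj₂ tree (closedWalk⇒HasCycle _ y z t (walk-prefix (_ ∷ y ∷ z ∷ t) (hop e W))
                                                                  (Unique[xs++x∷ys]⇒Unique[x∷xs] (y ∷ z ∷ t) uniq))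

  nonBacktracking⇒Unique : ∀ {u v xs} → Walk u v xs → NonBacktracking xs → Unique xs
  nonBacktracking⇒Unique (done _) _ = [] ∷ []
  nonBacktracking⇒Unique (hop e W) nb =
    ¬Any⇒All¬ _ (nonBacktracking-noReturn e W nb uniq) ∷ uniq
    where uniq = nonBacktracking⇒Unique W (nonBacktracking-tail _ _ nb)

  closedPath-trivial : ∀ {v} (P : Path v v) → vertices P ≡ [ v ]
  closedPath-trivial (mkPath _ (done _)      _)  = refl
  closedPath-trivial (mkPath _ W@(hop _ W′) nb) =
    contradiction (walk-end∈ W′) (Unique.Unique[x∷xs]⇒x∉xs (nonBacktracking⇒Unique W nb))

  path-unique : ∀ {u v} (P Q : Path u v) → vertices P ≡ vertices Q
  path-unique P Q = begin
    vertices P              ≡⟨ xs-split ⟩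
    stem ++ branch ∷ left   ≡⟨ cong (λ l → stem ++ branch ∷ l) (trans left≡[] (sym right≡[])) ⟩
    stem ++ branch ∷ right  ≡⟨ sym ys-split ⟩
    vertices Q              ∎
    where
    open ≡-Reasoning
    open Junction P Q
    left≡[]×right≡[] = ʳ++-singleton left right (closedPath-trivial detour)
    left≡[]  = proj₁ left≡[]×right≡[]
    right≡[] = proj₂ left≡[]×right≡[]

  path : ∀ u v → Path u v
  path u v = proj₁ (reduce (proj₁ (proj₂ (walkIn⇒walk (proj₂ (proj₁ tree) u v ∈⊤ ∈⊤)))))

  path-inside : ∀ {S u v} → Connected S → u ∈ S → v ∈ S → (P : Path u v) → All (_∈ S) (vertices P)
  path-inside {S} (_ , conn) u∈S v∈S P with walkIn⇒walk (conn _ _ u∈S v∈S)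
  ... | _ , W , W⊆S with reduce W
  ...   | R , R⊆W = subst (All (_∈ S)) (path-unique R P) (All-resp-⊇ R⊆W W⊆S)

  PathsInside : Subset n → Set
  PathsInside S = ∀ u v → u ∈ S → v ∈ S → All (_∈ S) (vertices (path u v))

  pathsInside⇒connected : ∀ {S} → Nonempty S → PathsInside S → Connected S
  pathsInside⇒connected S≢∅ within = S≢∅ , λ u v u∈S v∈S → walk⇒walkIn (walk (path u v)) (within u v u∈S v∈S)

  connected⇒pathsInside : ∀ {S} → Connected S → PathsInside S
  connected⇒pathsInside connS u v u∈S v∈S = path-inside connS u∈S v∈S (path u v)

  connected? : ∀ S → Dec (Connected S)
  connected? S = map′ (λ (S≢∅ , within) → pathsInside⇒connected S≢∅ within)
                      (λ connS → proj₁ connS , connected⇒pathsInside connS)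
                      (nonempty? S ×-dec Fin.all? λ u → Fin.all? λ v →
                         (u ∈? S) →-dec (v ∈? S) →-dec All.all? (_∈? S) (vertices (path u v)))

  ∩-connected : ∀ {A B} → Connected A → Connected B → Nonempty (A ∩ B) → Connected (A ∩ B)
  ∩-connected {A} {B} connA connB A∩B≢∅ = pathsInside⇒connected A∩B≢∅ λ u v u∈ v∈ →
    All.zipWith x∈p∩q⁺ ( connected⇒pathsInside connA u v (proj₁ (x∈p∩q⁻ A B u∈)) (proj₁ (x∈p∩q⁻ A B v∈))
                        , connected⇒pathsInside connB u v (proj₂ (x∈p∩q⁻ A B u∈)) (proj₂ (x∈p∩q⁻ A B v∈)))

  ⋂-connected : ∀ F → (∀ {A} → A ∈L F → Connected A) → Nonempty (⋂ F) → Connected (⋂ F)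
  ⋂-connected []      _      _     = proj₁ tree
  ⋂-connected (A ∷ F) connF ⋂≢∅@(x , x∈) =
    ∩-connected (connF (here refl)) (⋂-connected F (connF ∘ there) (x , proj₂ (x∈p∩q⁻ A (⋂ F) x∈))) ⋂≢∅

  median : ∀ {A B C} → Connected A → Connected B → Connected C →
           Nonempty (A ∩ B) → Nonempty (B ∩ C) → Nonempty (C ∩ A) → ∃ λ m → m ∈ A × m ∈ B × m ∈ C
  median {A} {B} {C} connA connB connC (a , a∈A∩B) (b , b∈B∩C) (c , c∈C∩A) =
    branch ,
    All.lookup (path-inside connA (proj₁ (x∈p∩q⁻ A B a∈A∩B)) (proj₂ (x∈p∩q⁻ C A c∈C∩A)) detour) branch∈detour ,
    All.lookup (path-inside connB (proj₁ (x∈p∩q⁻ B C b∈B∩C)) (proj₂ (x∈p∩q⁻ A B a∈A∩B)) (path b a)) branch∈P ,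
    All.lookup (path-inside connC (proj₂ (x∈p∩q⁻ B C b∈B∩C)) (proj₁ (x∈p∩q⁻ C A c∈C∩A)) (path b c)) branch∈Q
    where open Junction (path b a) (path b c)

  bridges-meet : ∀ {A₁ A₂ B B′} → Connected A₁ → Connected A₂ → Connected B → Connected B′ →
                 ¬ Nonempty (A₁ ∩ A₂) → Nonempty (A₁ ∩ B) → Nonempty (A₂ ∩ B) →
                 Nonempty (A₁ ∩ B′) → Nonempty (A₂ ∩ B′) → Nonempty (B ∩ B′)
  bridges-meet {A₁} {A₂} {B} {B′} connA₁ connA₂ connB connB′ A₁∩A₂≡∅ A₁∩B≢∅ (x , x∈A₂∩B) (y , y∈A₁∩B′) A₂∩B′≢∅ =
    meet (median connA₁ connB (∪-connected connB′ connA₂ (∩-comm-nonempty A₂∩B′≢∅)) A₁∩B≢∅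
                 (x , x∈p∩q⁺ (proj₂ (x∈p∩q⁻ A₂ B x∈A₂∩B) , q⊆p∪q B′ A₂ (proj₁ (x∈p∩q⁻ A₂ B x∈A₂∩B))))
                 (y , x∈p∩q⁺ (p⊆p∪q A₂ (proj₂ (x∈p∩q⁻ A₁ B′ y∈A₁∩B′)) , proj₁ (x∈p∩q⁻ A₁ B′ y∈A₁∩B′))))
    where
    meet : (∃ λ m → m ∈ A₁ × m ∈ B × m ∈ B′ ∪ A₂) → Nonempty (B ∩ B′)
    meet (m , m∈A₁ , m∈B , m∈B′∪A₂) with x∈p∪q⁻ B′ A₂ m∈B′∪A₂
    ... | inj₁ m∈B′ = m , x∈p∩q⁺ (m∈B , m∈B′)
    ... | inj₂ m∈A₂ = contradiction (m , x∈p∩q⁺ (m∈A₁ , m∈A₂)) A₁∩A₂≡∅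

  helly : ∀ {B} → Connected B → ∀ F → (∀ {A} → A ∈L F → Connected A) →
          (∀ {A} → A ∈L F → Nonempty (B ∩ A)) → (∀ {A A′} → A ∈L F → A′ ∈L F → Nonempty (A ∩ A′)) →
          Nonempty (B ∩ ⋂ F)
  helly ((x , x∈B) , _) [] _ _ _ = x , x∈p∩q⁺ (x∈B , ∈⊤)
  helly {B} connB (A ∷ F) connF meetsB pairwise =
    reassociate (helly (∩-connected connB connA (meetsB (here refl))) F (connF ∘ there) meetsB∩A
                       (λ A∈F A′∈F → pairwise (there A∈F) (there A′∈F)))
    where
    connA = connF (here refl)
    common : ∀ {A′} → (∃ λ m → m ∈ B × m ∈ A × m ∈ A′) → Nonempty ((B ∩ A) ∩ A′)
    common (m , m∈B , m∈A , m∈A′) = m , x∈p∩q⁺ (x∈p∩q⁺ (m∈B , m∈A) , m∈A′)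
    meetsB∩A : ∀ {A′} → A′ ∈L F → Nonempty ((B ∩ A) ∩ A′)
    meetsB∩A A′∈F = common (median connB connA (connF (there A′∈F)) (meetsB (here refl))
                                   (pairwise (here refl) (there A′∈F)) (∩-comm-nonempty (meetsB (there A′∈F))))
    reassociate : Nonempty ((B ∩ A) ∩ ⋂ F) → Nonempty (B ∩ (A ∩ ⋂ F))
    reassociate (v , v∈) = v , x∈p∩q⁺ (proj₁ (x∈p∩q⁻ B A v∈B∩A) , x∈p∩q⁺ (proj₂ (x∈p∩q⁻ B A v∈B∩A) , v∈⋂F))
      where
      v∈B∩A = proj₁ (x∈p∩q⁻ (B ∩ A) (⋂ F) v∈)
      v∈⋂F  = proj₂ (x∈p∩q⁻ (B ∩ A) (⋂ F) v∈)

  helly-⋂ : ∀ F → (∀ {A} → A ∈L F → Connected A) → (∀ {A A′} → A ∈L F → A′ ∈L F → Nonempty (A ∩ A′)) →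
            Nonempty (⋂ F)
  helly-⋂ F connF pairwise = drop-⊤ (helly (proj₁ tree) F connF (⊤-meets ∘ connF) pairwise)
    where
    ⊤-meets : ∀ {A} → Connected A → Nonempty (⊤ ∩ A)
    ⊤-meets ((x , x∈A) , _) = x , x∈p∩q⁺ (∈⊤ , x∈A)
    drop-⊤ : Nonempty (⊤ ∩ ⋂ F) → Nonempty (⋂ F)
    drop-⊤ (x , x∈) = x , proj₂ (x∈p∩q⁻ ⊤ (⋂ F) x∈)

module _ {n k : ℕ} where

  Conflict : Subset n → Fin k → Subset n → Fin k → Set
  Conflict H c H′ c′ = c ≡ c′ ⊎ Nonempty (H ∩ H′)

  conflict? : ∀ H c H′ c′ → Dec (Conflict H c H′ c′)
  conflict? H c H′ c′ = (c ≟ c′) ⊎-dec nonempty? (H ∩ H′)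

  conflict-sym : ∀ {H c H′ c′} → Conflict H c H′ c′ → Conflict H′ c′ H c
  conflict-sym (inj₁ c≡c′) = inj₁ (sym c≡c′)
  conflict-sym (inj₂ meet) = inj₂ (∩-comm-nonempty meet)

  Compatible : Subset n → Fin k → Subset n → Fin k → Set
  Compatible H c H′ c′ = (H , c) ≡ (H′ , c′) ⊎ ¬ Conflict H c H′ c′

  _≟ᴾ_ : (p q : Subset n × Fin k) → Dec (p ≡ q)
  _≟ᴾ_ = Product.≡-dec _≟ˢ_ _≟_

  indicator : {P : Set} → Dec P → ℤ
  indicator (yes _) = + 1
  indicator (no _)  = + 0

  indicator-01 : {P : Set} (P? : Dec P) → indicator P? ≡ + 0 ⊎ indicator P? ≡ + 1
  indicator-01 (yes _) = inj₂ refl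
  indicator-01 (no _)  = inj₁ refl

  indicator≢0 : {P : Set} (P? : Dec P) → indicator P? ≢ + 0 → P
  indicator≢0 (yes p) _   = p
  indicator≢0 (no _)  ≢0 = contradiction refl ≢0

  indicatorPoint : {P : Subset n → Fin k → Set} → (∀ H c → Dec (P H c)) → Point n k
  indicatorPoint P? H c = indicator (P? H c)

  unit : Subset n → Fin k → Point n k
  unit H₀ c₀ = indicatorPoint λ H c → (H , c) ≟ᴾ (H₀ , c₀)

  unit-on : ∀ H c → unit H c H c ≡ + 1
  unit-on H c with (H , c) ≟ᴾ (H , c)
  ... | yes _         = refl
  ... | no  different = contradiction refl different

  none : Subset n → Fin k → Dec ⊥
  none _ _ = no λ ()

  origin : Point n k
  origin = indicatorPoint none

  pair : Subset n → Fin k → Subset n → Fin k → Point n k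
  pair H₁ c₁ H₂ c₂ = indicatorPoint λ H c → ((H , c) ≟ᴾ (H₁ , c₁)) ⊎-dec ((H , c) ≟ᴾ (H₂ , c₂))

  erase : Point n k → Subset n → Fin k → Point n k
  erase x H₀ c₀ H c with (H , c) ≟ᴾ (H₀ , c₀)
  ... | yes _ = + 0
  ... | no  _ = x H c

  module _ (G : Graph n) where

    packing-feasible : ∀ {P : Subset n → Fin k → Set} (P? : ∀ H c → Dec (P H c)) →
                       (∀ {H c} → P H c → InducesConnected G H) →
                       (∀ {H c H′ c′} → P H c → P H′ c′ → Compatible H c H′ c′) →
                       Feasible G (indicatorPoint P?)
    packing-feasible {P} P? connected compatible =
      (λ H c → indicator-01 (P? H c)) , disconnected⇒0 , perVertex , perColour
      where
      x = indicatorPoint P?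
      x≤1 : ∀ H c → x H c ≤ℤ + 1
      x≤1 H c = 01⇒≤1 (indicator-01 (P? H c))
      disconnected⇒0 : ∀ H c → ¬ InducesConnected G H → x H c ≡ + 0
      disconnected⇒0 H c ¬conn with P? H c
      ... | yes p = contradiction (connected p) ¬conn
      ... | no  _ = refl
      perSet : ∀ H → ∑ (allFin k) (x H) ≤ℤ + 1
      perSet H = ∑≤1 (allFin k) (x H) (Unique.allFin⁺ k) (λ _ → x≤1 H _) oneColour
        where
        oneColour : ∀ {c c′} → c ∈L allFin k → c′ ∈L allFin k → x H c ≢ + 0 → x H c′ ≢ + 0 → c ≡ c′
        oneColour {c} {c′} _ _ ≢0 ≢0′ with compatible (indicator≢0 (P? H c) ≢0) (indicator≢0 (P? H c′) ≢0′)
        ... | inj₁ refl     = refl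
        ... | inj₂ ¬conflict with proj₁ (connected (indicator≢0 (P? H c) ≢0))
        ...   | v , v∈H = contradiction (inj₂ (v , x∈p∩q⁺ (v∈H , v∈H))) ¬conflict
      perVertex : ∀ v → (∑[ H ← setsContaining v ] ∑ (allFin k) (x H)) ≤ℤ + 1
      perVertex v = ∑≤1 (setsContaining v) _ (setsContaining-unique v) (λ _ → perSet _) oneSet
        where
        oneSet : ∀ {H H′} → H ∈L setsContaining v → H′ ∈L setsContaining v →
                 ∑ (allFin k) (x H) ≢ + 0 → ∑ (allFin k) (x H′) ≢ + 0 → H ≡ H′
        oneSet {H} {H′} H∈ H′∈ ≢0 ≢0′
          with ∑-nonZero (allFin k) (x H) ≢0 | ∑-nonZero (allFin k) (x H′) ≢0′
        ... | c , _ , xHc≢0 | c′ , _ , xH′c′≢0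
          with compatible (indicator≢0 (P? H c) xHc≢0) (indicator≢0 (P? H′ c′) xH′c′≢0)
        ...   | inj₁ refl     = refl
        ...   | inj₂ ¬conflict =
          contradiction (inj₂ (v , x∈p∩q⁺ (setsContaining⁻ H∈ , setsContaining⁻ H′∈))) ¬conflict
      perColour : ∀ c → (∑[ H ← allSubsets n ] x H c) ≤ℤ + 1
      perColour c = ∑≤1 (allSubsets n) (λ H → x H c) (allSubsets-unique n) (λ _ → x≤1 _ c) oneSet
        where
        oneSet : ∀ {H H′} → H ∈L allSubsets n → H′ ∈L allSubsets n → x H c ≢ + 0 → x H′ c ≢ + 0 → H ≡ H′
        oneSet {H} {H′} _ _ ≢0 ≢0′ with compatible (indicator≢0 (P? H c) ≢0) (indicator≢0 (P? H′ c) ≢0′)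
        ... | inj₁ refl      = refl
        ... | inj₂ ¬conflict = contradiction (inj₁ refl) ¬conflict

    feasible⇒compatible : ∀ {x} → Feasible G x →
                          ∀ {H c H′ c′} → x H c ≡ + 1 → x H′ c′ ≡ + 1 → Compatible H c H′ c′
    feasible⇒compatible {x} (x01 , _ , perVertex , perColour) {H} {c} {H′} {c′} x≡1 x′≡1
      with (H , c) ≟ᴾ (H′ , c′)
    ... | yes same = inj₁ same
    ... | no  different = inj₂ conflict⇒⊥
      where
      0≤x : ∀ H c → + 0 ≤ℤ x H c
      0≤x H c = 01⇒0≤ (x01 H c)
      0≤∑x : ∀ H → + 0 ≤ℤ ∑ (allFin k) (x H)
      0≤∑x H = ∑-nonNegative (allFin k) (λ _ → 0≤x H _)
      conflict⇒⊥ : ¬ Conflict H c H′ c′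
      conflict⇒⊥ (inj₁ refl) = 1+1≰1 x≡1 x′≡1 (≤-trans
        (twoTerms≤∑ (allSubsets n) (λ _ → 0≤x _ c) (allSubsets-complete H) (allSubsets-complete H′)
                    λ { refl → different refl })
        (perColour c))
      conflict⇒⊥ (inj₂ (v , v∈H∩H′)) with x∈p∩q⁻ H H′ v∈H∩H′ | H ≟ˢ H′
      ... | v∈H , _ | yes refl = 1+1≰1 x≡1 x′≡1 (≤-trans
              (twoTerms≤∑ (allFin k) (λ _ → 0≤x H _) (∈-allFin c) (∈-allFin c′) λ { refl → different refl })
              (≤-trans (term≤∑ (setsContaining v) (λ _ → 0≤∑x _) (setsContaining⁺ v∈H)) (perVertex v)))
      ... | v∈H , v∈H′ | no H≢H′ = 1+1≰1 x≡1 x′≡1 (≤-trans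
              (+-mono-≤ (term≤∑ (allFin k) (λ _ → 0≤x H _) (∈-allFin c))
                        (term≤∑ (allFin k) (λ _ → 0≤x H′ _) (∈-allFin c′)))
              (≤-trans (twoTerms≤∑ (setsContaining v) (λ _ → 0≤∑x _)
                                   (setsContaining⁺ v∈H) (setsContaining⁺ v∈H′) H≢H′)
                       (perVertex v)))

    unit-feasible : ∀ {H₀} c₀ → InducesConnected G H₀ → Feasible G (unit H₀ c₀)
    unit-feasible c₀ connH₀ = packing-feasible _ (λ { refl → connH₀ }) λ { refl refl → inj₁ refl }

    origin-feasible : Feasible G origin
    origin-feasible = packing-feasible none (λ ()) λ ()

    pair-feasible : ∀ {H₁ H₂} c₁ c₂ → InducesConnected G H₁ → InducesConnected G H₂ →
                    ¬ Conflict H₁ c₁ H₂ c₂ → Feasible G (pair H₁ c₁ H₂ c₂)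
    pair-feasible c₁ c₂ connH₁ connH₂ ¬conflict = packing-feasible _
      (λ { (inj₁ refl) → connH₁ ; (inj₂ refl) → connH₂ })
      λ { (inj₁ refl) (inj₁ refl) → inj₁ refl
        ; (inj₁ refl) (inj₂ refl) → inj₂ ¬conflict
        ; (inj₂ refl) (inj₁ refl) → inj₂ (¬conflict ∘ conflict-sym)
        ; (inj₂ refl) (inj₂ refl) → inj₁ refl }

    feasible-downward : ∀ {x y} → Feasible G x → (∀ H c → y H c ≡ + 0 ⊎ y H c ≡ + 1) →
                        (∀ H c → y H c ≤ℤ x H c) → Feasible G y
    feasible-downward {x} {y} (_ , disconnected⇒0 , perVertex , perColour) y01 y≤x =
      y01 , disconnected⇒0′ ,
      (λ v → ≤-trans (∑-mono-≤ (setsContaining v) λ {H} _ → ∑-mono-≤ (allFin k) λ {c} _ → y≤x H c)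
                     (perVertex v)) ,
      (λ c → ≤-trans (∑-mono-≤ (allSubsets n) λ {H} _ → y≤x H c) (perColour c))
      where
      disconnected⇒0′ : ∀ H c → ¬ InducesConnected G H → y H c ≡ + 0
      disconnected⇒0′ H c ¬conn with y01 H c
      ... | inj₁ y≡0 = y≡0
      ... | inj₂ y≡1 with subst₂ _≤ℤ_ y≡1 (disconnected⇒0 H c ¬conn) (y≤x H c)
      ...   | +≤+ ()

    erase-feasible : ∀ {x} H₀ c₀ → Feasible G x → Feasible G (erase x H₀ c₀)
    erase-feasible {x} H₀ c₀ feasible@(x01 , _) = feasible-downward feasible erase01 erase≤x
      where
      erase01 : ∀ H c → erase x H₀ c₀ H c ≡ + 0 ⊎ erase x H₀ c₀ H c ≡ + 1
      erase01 H c with (H , c) ≟ᴾ (H₀ , c₀)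
      ... | yes _ = inj₁ refl
      ... | no  _ = x01 H c
      erase≤x : ∀ H c → erase x H₀ c₀ H c ≤ℤ x H c
      erase≤x H c with (H , c) ≟ᴾ (H₀ , c₀)
      ... | yes _ = 01⇒0≤ (x01 H c)
      ... | no  _ = ≤-refl

  module _ (π : Point n k) where

    dot-cong : ∀ {x y : Point n k} → (∀ H c → x H c ≡ y H c) → dot π x ≡ dot π y
    dot-cong x≡y = ∑-cong (allSubsets n) λ {H} _ → ∑-cong (allFin k) λ {c} _ → cong (π H c *_) (x≡y H c)

    dot-zero : ∀ {x : Point n k} → (∀ H c → x H c ≡ + 0) → dot π x ≡ + 0
    dot-zero x≡0 = ∑-zero (allSubsets n) λ {H} _ → ∑-zero (allFin k) λ {c} _ →
                     trans (cong (π H c *_) (x≡0 H c)) (*-zeroʳ (π H c))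

    dot-+ : ∀ {x y z : Point n k} → (∀ H c → x H c ≡ y H c + z H c) → dot π x ≡ dot π y + dot π z
    dot-+ {x} {y} {z} x≡y+z = begin
      dot π x                                                 ≡⟨ dot-cong x≡y+z ⟩
      (∑[ H ← allSubsets n ] ∑[ c ← allFin k ] π H c * (y H c + z H c))
        ≡⟨ ∑-cong (allSubsets n) (λ {H} _ → trans (∑-cong (allFin k) λ {c} _ → *-distribˡ-+ (π H c) (y H c) (z H c))
                                                  (∑-+ (allFin k) _ _)) ⟩
      (∑[ H ← allSubsets n ] (∑[ c ← allFin k ] π H c * y H c) + (∑[ c ← allFin k ] π H c * z H c))
        ≡⟨ ∑-+ (allSubsets n) _ _ ⟩
      dot π y + dot π z                                       ∎
      where open ≡-Reasoning

    dot-unit : ∀ H₀ c₀ → dot π (unit H₀ c₀) ≡ π H₀ c₀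
    dot-unit H₀ c₀ =
      trans (∑-singleTerm (allSubsets n) _ (allSubsets-unique n) (allSubsets-complete H₀) λ _ H≢H₀ →
               ∑-zero (allFin k) λ _ → π*unit-off (H≢H₀ ∘ ,-injectiveˡ))
      (trans (∑-singleTerm (allFin k) _ (Unique.allFin⁺ k) (∈-allFin c₀) λ _ c≢c₀ →
                π*unit-off (c≢c₀ ∘ ,-injectiveʳ))
             π*unit-on)
      where
      π*unit-off : ∀ {H c} → (H , c) ≢ (H₀ , c₀) → π H c * unit H₀ c₀ H c ≡ + 0
      π*unit-off {H} {c} different with (H , c) ≟ᴾ (H₀ , c₀)
      ... | yes same = contradiction same different
      ... | no  _ = *-zeroʳ (π H c)
      π*unit-on : π H₀ c₀ * unit H₀ c₀ H₀ c₀ ≡ π H₀ c₀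
      π*unit-on = trans (cong (π H₀ c₀ *_) (unit-on H₀ c₀)) (*-identityʳ (π H₀ c₀))

    dot-pair : ∀ H₁ c₁ H₂ c₂ → c₁ ≢ c₂ → dot π (pair H₁ c₁ H₂ c₂) ≡ π H₁ c₁ + π H₂ c₂
    dot-pair H₁ c₁ H₂ c₂ c₁≢c₂ = trans (dot-+ pair≡unit+unit) (cong₂ _+_ (dot-unit H₁ c₁) (dot-unit H₂ c₂))
      where
      pair≡unit+unit : ∀ H c → pair H₁ c₁ H₂ c₂ H c ≡ unit H₁ c₁ H c + unit H₂ c₂ H c
      pair≡unit+unit H c with (H , c) ≟ᴾ (H₁ , c₁) | (H , c) ≟ᴾ (H₂ , c₂)
      ... | yes refl | yes eq = contradiction (,-injectiveʳ eq) c₁≢c₂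
      ... | yes _    | no  _  = refl
      ... | no  _    | yes _  = refl
      ... | no  _    | no  _  = refl

    dot-erase : ∀ {x} H₀ c₀ → x H₀ c₀ ≡ + 1 → dot π x ≡ dot π (erase x H₀ c₀) + π H₀ c₀
    dot-erase {x} H₀ c₀ x≡1 = trans (dot-+ x≡erase+unit) (cong (λ s → dot π (erase x H₀ c₀) + s) (dot-unit H₀ c₀))
      where
      x≡erase+unit : ∀ H c → x H c ≡ erase x H₀ c₀ H c + unit H₀ c₀ H c
      x≡erase+unit H c with (H , c) ≟ᴾ (H₀ , c₀)
      ... | yes refl = x≡1
      ... | no  _    = sym (+-identityʳ (x H c))

  combination : ∀ {m} → (Fin m → ℤ) → (Fin m → Point n k) → Point n k
  combination {m} μ ps H c = ∑[ i ← allFin m ] μ i * ps i H c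

  dot-combination : ∀ (π : Point n k) {m} (μ : Fin m → ℤ) (ps : Fin m → Point n k) →
                    dot π (combination μ ps) ≡ (∑[ i ← allFin m ] μ i * dot π (ps i))
  dot-combination π {m} μ ps = begin
    dot π (combination μ ps)
      ≡⟨ ∑-cong (allSubsets n) (λ {H} _ → ∑-cong (allFin k) λ {c} _ →
           trans (*-∑ (allFin m) (π H c) _) (∑-cong (allFin m) λ {i} _ → x[yz]≡y[xz] (π H c) (μ i) (ps i H c))) ⟩
    (∑[ H ← allSubsets n ] ∑[ c ← allFin k ] ∑[ i ← allFin m ] μ i * (π H c * ps i H c))
      ≡⟨ ∑-cong (allSubsets n) (λ _ → ∑-comm (allFin k) (allFin m) _) ⟩
    (∑[ H ← allSubsets n ] ∑[ i ← allFin m ] ∑[ c ← allFin k ] μ i * (π H c * ps i H c))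
      ≡⟨ ∑-comm (allSubsets n) (allFin m) _ ⟩
    (∑[ i ← allFin m ] ∑[ H ← allSubsets n ] ∑[ c ← allFin k ] μ i * (π H c * ps i H c))
      ≡⟨ ∑-cong (allFin m) (λ {i} _ → sym (trans (*-∑ (allSubsets n) (μ i) _)
                                                 (∑-cong (allSubsets n) λ _ → *-∑ (allFin k) (μ i) _))) ⟩
    (∑[ i ← allFin m ] μ i * dot π (ps i)) ∎
    where
    open ≡-Reasoning
    x[yz]≡y[xz] : ∀ x y z → x * (y * z) ≡ y * (x * z)
    x[yz]≡y[xz] = solve-∀

  combination-∷ : ∀ {m} (μ : Fin (suc m) → ℤ) q (ps : Fin m → Point n k) H c →
                  combination μ (q ∷ᶠ ps) H c ≡ μ zero * q H c + combination (μ ∘ suc) ps H c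
  combination-∷ μ q ps H c = ∑-allFin-suc λ i → μ i * (q ∷ᶠ ps) i H c

  affinelyIndependent-∷ : ∀ {m} q (ps : Fin m → Point n k) → AffinelyIndependent ps →
    (∀ μ → ∑ (allFin (suc m)) μ ≡ + 0 → (∀ H c → combination μ (q ∷ᶠ ps) H c ≡ + 0) → μ zero ≡ + 0) →
    AffinelyIndependent (q ∷ᶠ ps)
  affinelyIndependent-∷ q ps _     head≡0 μ ∑≡0 comb≡0 zero    = head≡0 μ ∑≡0 comb≡0
  affinelyIndependent-∷ q ps indep head≡0 μ ∑≡0 comb≡0 (suc i) = indep (μ ∘ suc) tail∑≡0 tailComb≡0 i
    where
    open ≡-Reasoning
    μ₀≡0 = head≡0 μ ∑≡0 comb≡0
    tail∑≡0 : ∑ (allFin _) (μ ∘ suc) ≡ + 0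
    tail∑≡0 = trans (sym (+-identityˡ _)) (trans (cong (λ z → z + ∑ (allFin _) (μ ∘ suc)) (sym μ₀≡0))
                                                 (trans (sym (∑-allFin-suc μ)) ∑≡0))
    tailComb≡0 : ∀ H c → combination (μ ∘ suc) ps H c ≡ + 0
    tailComb≡0 H c = begin
      combination (μ ∘ suc) ps H c                      ≡⟨ sym (+-identityˡ _) ⟩
      + 0 * q H c + combination (μ ∘ suc) ps H c
        ≡⟨ cong (λ z → z * q H c + combination (μ ∘ suc) ps H c) (sym μ₀≡0) ⟩
      μ zero * q H c + combination (μ ∘ suc) ps H c     ≡⟨ sym (combination-∷ μ q ps H c) ⟩
      combination μ (q ∷ᶠ ps) H c                       ≡⟨ comb≡0 H c ⟩
      + 0                                               ∎

  affinelyIndependent-∷-coordinate : ∀ {m} q (ps : Fin m → Point n k) H c → q H c ≡ + 1 →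
    (∀ i → ps i H c ≡ + 0) → AffinelyIndependent ps → AffinelyIndependent (q ∷ᶠ ps)
  affinelyIndependent-∷-coordinate q ps H c q≡1 ps≡0 indep =
    affinelyIndependent-∷ q ps indep λ μ _ comb≡0 → begin
      μ zero                                         ≡⟨ sym (*-identityʳ (μ zero)) ⟩
      μ zero * + 1                                   ≡⟨ cong (μ zero *_) (sym q≡1) ⟩
      μ zero * q H c                                 ≡⟨ sym (+-identityʳ _) ⟩
      μ zero * q H c + + 0                           ≡⟨ cong (λ s → μ zero * q H c + s) (sym (tail≡0 μ)) ⟩
      μ zero * q H c + combination (μ ∘ suc) ps H c  ≡⟨ sym (combination-∷ μ q ps H c) ⟩
      combination μ (q ∷ᶠ ps) H c                    ≡⟨ comb≡0 H c ⟩
      + 0                                            ∎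
    where
    open ≡-Reasoning
    tail≡0 : ∀ μ → combination (μ ∘ suc) ps H c ≡ + 0
    tail≡0 μ = ∑-zero (allFin _) λ {i} _ → trans (cong (μ (suc i) *_) (ps≡0 i)) (*-zeroʳ (μ (suc i)))

  affinelyIndependent-∷-origin : ∀ (π : Point n k) {m} (ps : Fin m → Point n k) →
    (∀ i → dot π (ps i) ≡ + 1) → AffinelyIndependent ps → AffinelyIndependent (origin ∷ᶠ ps)
  affinelyIndependent-∷-origin π {m} ps onHyperplane indep = affinelyIndependent-∷ origin ps indep head≡0
    where
    open ≡-Reasoning
    head≡0 : ∀ μ → ∑ (allFin (suc m)) μ ≡ + 0 → (∀ H c → combination μ (origin ∷ᶠ ps) H c ≡ + 0) → μ zero ≡ + 0
    head≡0 μ ∑≡0 comb≡0 = begin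
      μ zero                            ≡⟨ sym (+-identityʳ (μ zero)) ⟩
      μ zero + + 0                      ≡⟨ cong (λ s → μ zero + s) (sym tail∑≡0) ⟩
      μ zero + ∑ (allFin m) (μ ∘ suc)   ≡⟨ sym (∑-allFin-suc μ) ⟩
      ∑ (allFin (suc m)) μ              ≡⟨ ∑≡0 ⟩
      + 0                               ∎
      where
      tailComb≡0 : ∀ H c → combination (μ ∘ suc) ps H c ≡ + 0
      tailComb≡0 H c = begin
        combination (μ ∘ suc) ps H c                         ≡⟨ sym (+-identityˡ _) ⟩
        + 0 + combination (μ ∘ suc) ps H c
          ≡⟨ cong (λ s → s + combination (μ ∘ suc) ps H c) (sym (*-zeroʳ (μ zero))) ⟩
        μ zero * origin H c + combination (μ ∘ suc) ps H c   ≡⟨ sym (combination-∷ μ origin ps H c) ⟩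
        combination μ (origin ∷ᶠ ps) H c                     ≡⟨ comb≡0 H c ⟩
        + 0                                                  ∎
      tail∑≡0 : ∑ (allFin m) (μ ∘ suc) ≡ + 0
      tail∑≡0 = begin
        ∑ (allFin m) (μ ∘ suc)                          ≡⟨ ∑-cong (allFin m) (λ {i} _ →
                                                             trans (sym (*-identityʳ (μ (suc i))))
                                                                   (cong (μ (suc i) *_) (sym (onHyperplane i)))) ⟩
        (∑[ i ← allFin m ] μ (suc i) * dot π (ps i))   ≡⟨ sym (dot-combination π (μ ∘ suc) ps) ⟩
        dot π (combination (μ ∘ suc) ps)                ≡⟨ dot-zero π tailComb≡0 ⟩
        + 0                                             ∎

module _ {n k : ℕ} where

  StarMember : Subset n → Fin k → Subset n → Fin k → Set
  StarMember H* c* H c = (c ≡ c* × Nonempty (H ∩ H*)) ⊎ (c ≢ c* × H* ⊆ H)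

  starCoeff-member : ∀ {H* c* H c} → StarMember H* c* H c → starCoeff H* c* H c ≡ + 1
  starCoeff-member {H*} {c*} {H} {c} (inj₁ (c≡c* , meet)) with c ≟ c*
  ... | no  c≢c* = contradiction c≡c* c≢c*
  ... | yes _ with nonempty? (H ∩ H*)
  ...   | yes _      = refl
  ...   | no  H∩H*≡∅ = contradiction meet H∩H*≡∅
  starCoeff-member {H*} {c*} {H} {c} (inj₂ (c≢c* , H*⊆H)) with c ≟ c*
  ... | yes c≡c* = contradiction c≡c* c≢c*
  ... | no  _ with H* ⊆? H
  ...   | yes _    = refl
  ...   | no  H*⊈H = contradiction (λ {x} → H*⊆H {x}) H*⊈H

  starCoeff-cases : ∀ H* c* H c → starCoeff H* c* H c ≡ + 0 ⊎ StarMember H* c* H c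
  starCoeff-cases H* c* H c with c ≟ c*
  ... | yes c≡c* with nonempty? (H ∩ H*)
  ...   | yes meet = inj₂ (inj₁ (c≡c* , meet))
  ...   | no  _    = inj₁ refl
  starCoeff-cases H* c* H c | no c≢c* with H* ⊆? H
  ...   | yes H*⊆H = inj₂ (inj₂ (c≢c* , H*⊆H))
  ...   | no  _    = inj₁ refl

  star-conflict : ∀ {H* c* H c H′ c′} → Nonempty H* →
                  StarMember H* c* H c → StarMember H* c* H′ c′ → Conflict H c H′ c′
  star-conflict _ (inj₁ (c≡c* , _)) (inj₁ (c′≡c* , _)) = inj₁ (trans c≡c* (sym c′≡c*))
  star-conflict {H*} {H = H} _ (inj₁ (_ , (x , x∈H∩H*))) (inj₂ (_ , H*⊆H′)) =
    inj₂ (x , x∈p∩q⁺ (proj₁ (x∈p∩q⁻ H H* x∈H∩H*) , H*⊆H′ (proj₂ (x∈p∩q⁻ H H* x∈H∩H*))))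
  star-conflict {H*} {H′ = H′} _ (inj₂ (_ , H*⊆H)) (inj₁ (_ , (x , x∈H′∩H*))) =
    inj₂ (x , x∈p∩q⁺ (H*⊆H (proj₂ (x∈p∩q⁻ H′ H* x∈H′∩H*)) , proj₁ (x∈p∩q⁻ H′ H* x∈H′∩H*)))
  star-conflict (x , x∈H*) (inj₂ (_ , H*⊆H)) (inj₂ (_ , H*⊆H′)) = inj₂ (x , x∈p∩q⁺ (H*⊆H x∈H* , H*⊆H′ x∈H*))

module FacetCoefficients {n k : ℕ} (G : Graph n) (connected? : ∀ H → Dec (InducesConnected G H))
  (π : Point n k) (valid : ∀ x → Feasible G x → dot π x ≤ℤ + 1)
  {d : ℕ} (dimension : ¬ HasAffIndep {n} {k} (Feasible G) (suc (suc d)))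
  (ps : Fin d → Point n k) (onFace : ∀ i → Feasible G (ps i) × dot π (ps i) ≡ + 1)
  (independent : AffinelyIndependent ps) where

  Support : Subset n → Fin k → Set
  Support H c = InducesConnected G H × π H c ≡ + 1

  -- Otherwise the unit vector at (H , c), the origin and the d tight points would be
  -- d + 2 affinely independent feasible points.
  face-covers : ∀ {H} c → InducesConnected G H → ∃ λ i → ps i H c ≡ + 1
  face-covers {H} c connH with Fin.any? (λ i → ps i H c ≟ℤ + 1)
  ... | yes covered   = covered
  ... | no  uncovered = contradiction (unit H c ∷ᶠ origin ∷ᶠ ps , feasible , independent′) dimension
    where
    ps≡0 : ∀ i → ps i H c ≡ + 0
    ps≡0 i with proj₁ (proj₁ (onFace i)) H c
    ... | inj₁ ≡0 = ≡0
    ... | inj₂ ≡1 = contradiction (i , ≡1) uncovered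
    feasible : ∀ i → Feasible G ((unit H c ∷ᶠ origin ∷ᶠ ps) i)
    feasible zero          = unit-feasible G c connH
    feasible (suc zero)    = origin-feasible G
    feasible (suc (suc i)) = proj₁ (onFace i)
    independent′ : AffinelyIndependent (unit H c ∷ᶠ origin ∷ᶠ ps)
    independent′ = affinelyIndependent-∷-coordinate (unit H c) (origin ∷ᶠ ps) H c (unit-on H c)
                     (λ { zero → refl ; (suc i) → ps≡0 i })
                     (affinelyIndependent-∷-origin π ps (proj₂ ∘ onFace) independent)

  -- π H c ≤ 1 by validity at the unit vector, and π H c ≥ 0 because a tight point using
  -- (H , c) stays feasible when (H , c) is removed.
  coefficient-01 : ∀ {H} c → InducesConnected G H → π H c ≡ + 0 ⊎ π H c ≡ + 1
  coefficient-01 {H} c connH with face-covers c connH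
  ... | i , x≡1 = 0≤z≤1⇒01 (π H c) 0≤π π≤1
    where
    π≤1 : π H c ≤ℤ + 1
    π≤1 = subst (_≤ℤ + 1) (dot-unit π H c) (valid _ (unit-feasible G c connH))
    0≤π : + 0 ≤ℤ π H c
    0≤π = y+z≡1⇒y≤1⇒0≤z (π H c) (trans (sym (dot-erase π H c x≡1)) (proj₂ (onFace i)))
                          (valid _ (erase-feasible G H c (proj₁ (onFace i))))

  support-conflict : ∀ {H c H′ c′} → Support H c → Support H′ c′ → Conflict H c H′ c′
  support-conflict {H} {c} {H′} {c′} (connH , π≡1) (connH′ , π′≡1) with conflict? H c H′ c′
  ... | yes conflict  = conflict
  ... | no  ¬conflict with subst (_≤ℤ + 1) (trans (dot-pair π H c H′ c′ (¬conflict ∘ inj₁)) (cong₂ _+_ π≡1 π′≡1))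
                                          (valid _ (pair-feasible G c c′ connH connH′ ¬conflict))
  ...   | +≤+ (s≤s ())

  support-maximal : ∀ {H₀ c₀} → InducesConnected G H₀ → π H₀ c₀ ≡ + 0 →
                    ∃₂ λ H c → Support H c × ¬ Conflict H₀ c₀ H c
  support-maximal {H₀} {c₀} connH₀ π≡0 with face-covers c₀ connH₀
  ... | i , xH₀c₀≡1 with ∑-nonZero (allSubsets n) _ (λ dot≡0 → case trans (sym (proj₂ (onFace i))) dot≡0 of λ ())
  ...   | H , _ , ∑≢0 with ∑-nonZero (allFin k) _ ∑≢0
  ...     | c , _ , πx≢0 = H , c , (connH , π≡1) , ¬conflict
    where
    x = ps i
    x-feasible = proj₁ (onFace i)
    x≢0 : x H c ≢ + 0
    x≢0 x≡0 = πx≢0 (trans (cong (π H c *_) x≡0) (*-zeroʳ (π H c)))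
    π≢0 : π H c ≢ + 0
    π≢0 π≡0′ = πx≢0 (cong (_* x H c) π≡0′)
    connH : InducesConnected G H
    connH with connected? H
    ... | yes conn = conn
    ... | no ¬conn = contradiction (proj₁ (proj₂ x-feasible) H c ¬conn) x≢0
    π≡1 : π H c ≡ + 1
    π≡1 = 01∧≢0⇒≡1 (coefficient-01 c connH) π≢0
    ¬conflict : ¬ Conflict H₀ c₀ H c
    ¬conflict with feasible⇒compatible G x-feasible xH₀c₀≡1 (01∧≢0⇒≡1 (proj₁ x-feasible H c) x≢0)
    ... | inj₁ refl       = contradiction π≡0 π≢0
    ... | inj₂ ¬conflict′ = ¬conflict′

  support? : ∀ H c → Dec (Support H c)
  support? H c = connected? H ×-dec (π H c ≟ℤ + 1)

  support⊆star⇒coefficients : ∀ {H* c*} → Nonempty H* →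
                              (∀ {H c} → Support H c → StarMember H* c* H c) →
                              ∀ H c → InducesConnected G H → π H c ≡ starCoeff H* c* H c
  support⊆star⇒coefficients {H*} {c*} H*≢∅ support⊆star H c connH =
    [ π≡0⇒ , π≡1⇒ ]′ (coefficient-01 c connH)
    where
    π≡1⇒ : π H c ≡ + 1 → π H c ≡ starCoeff H* c* H c
    π≡1⇒ π≡1 = trans π≡1 (sym (starCoeff-member (support⊆star (connH , π≡1))))
    nonMember : π H c ≡ + 0 → ¬ StarMember H* c* H c
    nonMember π≡0 member =
      let (_ , _ , inSupport , ¬conflict) = support-maximal connH π≡0
      in  ¬conflict (star-conflict H*≢∅ member (support⊆star inSupport))
    π≡0⇒ : π H c ≡ + 0 → π H c ≡ starCoeff H* c* H c
    π≡0⇒ π≡0 = [ (λ star≡0 → trans π≡0 (sym star≡0)) , (λ member → contradiction member (nonMember π≡0)) ]′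
                   (starCoeff-cases H* c* H c)

module CliquesOfSubtrees {n k : ℕ} (G : Graph n) (tree : IsTree G)
  (K : Subset n → Fin k → Set) (K? : ∀ H c → Dec (K H c))
  (K-connected : ∀ {H c} → K H c → InducesConnected G H)
  (K-clique : ∀ {H c H′ c′} → K H c → K H′ c′ → Conflict H c H′ c′) where

  open Trees G tree

  meets-otherColour : ∀ {A H c* c} → K A c* → K H c → c ≢ c* → Nonempty (A ∩ H)
  meets-otherColour KA KH c≢c* with K-clique KA KH
  ... | inj₁ c*≡c = contradiction (sym c*≡c) c≢c*
  ... | inj₂ meet = meet

  otherColour? : ∀ c* H → Dec (∃ λ c → c ≢ c* × K H c)
  otherColour? c* H = Fin.any? λ c → ¬? (c ≟ c*) ×-dec K? H c

  otherColoured : Fin k → List (Subset n)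
  otherColoured c* = filter (otherColour? c*) (allSubsets n)

  module StarFor (c* : Fin k) (sameColourMeet : ∀ {H H′ c} → K H c → K H′ c → c ≢ c* → Nonempty (H ∩ H′)) where

    F = otherColoured c*

    member : ∀ {A} → A ∈L F → ∃ λ c → c ≢ c* × K A c
    member A∈F = proj₂ (∈-filter⁻ (otherColour? c*) {xs = allSubsets n} A∈F)

    F-complete : ∀ {A c} → c ≢ c* → K A c → A ∈L F
    F-complete {A} {c} c≢c* KA = ∈-filter⁺ (otherColour? c*) (allSubsets-complete A) (c , c≢c* , KA)

    F-connected : ∀ {A} → A ∈L F → Connected A
    F-connected A∈F = K-connected (proj₂ (proj₂ (member A∈F)))

    F-pairwise : ∀ {A A′} → A ∈L F → A′ ∈L F → Nonempty (A ∩ A′)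
    F-pairwise A∈F A′∈F with member A∈F | member A′∈F
    ... | c , c≢c* , KA | c′ , _ , KA′ with c ≟ c′
    ...   | yes refl = sameColourMeet KA KA′ c≢c*
    ...   | no  c≢c′ with K-clique KA KA′
    ...     | inj₁ c≡c′ = contradiction c≡c′ c≢c′
    ...     | inj₂ meet = meet

    ⋂F-nonempty : Nonempty (⋂ F)
    ⋂F-nonempty = helly-⋂ F F-connected F-pairwise

    K⊆star : ∀ {H c} → K H c → StarMember (⋂ F) c* H c
    K⊆star {H} {c} KH with c ≟ c*
    ... | yes refl = inj₁ (refl , helly (K-connected KH) F F-connected meetsF F-pairwise)
      where
      meetsF : ∀ {A} → A ∈L F → Nonempty (H ∩ A)
      meetsF A∈F = let (_ , c≢c* , KA) = member A∈F in meets-otherColour KH KA c≢c*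
    ... | no  c≢c* = inj₂ (c≢c* , λ x∈⋂F → ∈⋂⁻ F x∈⋂F (F-complete c≢c* KH))

  clique-in-star-at : ∀ c* → (∀ {H H′ c} → K H c → K H′ c → c ≢ c* → Nonempty (H ∩ H′)) →
                      ∃₂ λ H* c* → Connected H* × (∀ {H c} → K H c → StarMember H* c* H c)
  clique-in-star-at c* sameColourMeet = ⋂ F , c* , ⋂-connected F F-connected ⋂F-nonempty , K⊆star
    where open StarFor c* sameColourMeet

  -- c* is the colour of two disjoint sets of K if there are such, and c₀ otherwise.
  clique-in-star : Fin k → ∃₂ λ H* c* → Connected H* × (∀ {H c} → K H c → StarMember H* c* H c)
  clique-in-star c₀ with Fin.any? (λ c → anySubset? λ A₁ → anySubset? λ A₂ →
                                          K? A₁ c ×-dec K? A₂ c ×-dec ¬? (nonempty? (A₁ ∩ A₂)))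
  ... | yes (c* , A₁ , A₂ , KA₁ , KA₂ , A₁∩A₂≡∅) = clique-in-star-at c* λ KH KH′ c≢c* →
          bridges-meet (K-connected KA₁) (K-connected KA₂) (K-connected KH) (K-connected KH′) A₁∩A₂≡∅
                       (meets-otherColour KA₁ KH c≢c*) (meets-otherColour KA₂ KH c≢c*)
                       (meets-otherColour KA₁ KH′ c≢c*) (meets-otherColour KA₂ KH′ c≢c*)
  ... | no noDisjointPair = clique-in-star-at c₀ λ {H} {H′} {c} KH KH′ _ → decidable-stable (nonempty? (H ∩ H′))
          λ H∩H′≡∅ → noDisjointPair (c , H , H′ , KH , KH′ , H∩H′≡∅)

-- The colouring C and the bounds on n and k play no role (k ≥ 1 provides a default colour),
-- and of FacetDefining only validity, the dimension bound and the tight points are used.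
theorem6 : (n k : ℕ) → 3 ≤ n → 2 ≤ k →
    (G : Graph n) → IsTree G →
    (C : Fin n → Maybe (Fin k)) →
    (π : Point n k) →
    FacetDefining G π →
    ∃ λ (Hs : Subset n) → ∃ λ (cs : Fin k) →
      InducesConnected G Hs ×
      (∀ (H' : Subset n) (c' : Fin k) → InducesConnected G H' →
         π H' c' ≡ starCoeff Hs cs H' c')
theorem6 n (suc k) _ _ G tree _ π (valid , _ , _ , _ , dimension , ps , onFace , independent) =
  let (H* , c* , connH* , support⊆star) = clique-in-star zero
  in  H* , c* , connH* , support⊆star⇒coefficients (proj₁ connH*) support⊆star
  where
  open Trees G tree using (connected?)
  open FacetCoefficients G connected? π valid dimension ps onFace independent
  open CliquesOfSubtrees G tree Support support? proj₁ support-conflict
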